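{- For every real number $\varepsilon>0$ and every positive integer $k$, there exists a digraph $G$ such that $\alpha(G)=k$ and $\gamma^*(G)>2k-\varepsilon$.
   Context: All digraphs are finite, loopless and simple (for any two vertices $u,v$ there is at most one arc with endpoints $\{u,v\}$). $\alpha(G)$ is the independence number of the underlying undirected graph of $G$. A fractional dominating function of $G=(V,E)$ is a function $g:V\to[0,1]$ with $\sum_{x\in N^-[v]}g(x)\ge 1$ for every $v\in V$, where $N^-[v]$ is $v$ together with its in-neighbors; $\gamma^*(G)$ is the minimum of $\sum_{v\in V}g(v)$ over all such $g$.
   Formalization: The number ε ranges over positive rationals instead of positive reals, and the fractional dominating functions defining $\gamma^*(G)$ take only rational values. -}

module Defs where

open import Data.Nat as ℕ using (ℕ; zero; suc)
open import Data.Bool using (Bool; true; false; _∨_)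
open import Data.Fin using (Fin; zero; suc; _≟_)
open import Data.Fin.Subset using (Subset; _∈_; ∣_∣)
open import Data.Product using (Σ; _×_; ∃)
open import Data.Integer using (+_)
open import Data.Rational using (ℚ; 0ℚ; 1ℚ; _+_; _/_; _≤_)
open import Relation.Nullary.Decidable using (⌊_⌋)
open import Relation.Binary.PropositionalEquality using (_≡_)

record Digraph : Set where
  field
    n        : ℕ
    arc      : Fin n → Fin n → Bool
    loopless : ∀ v → arc v v ≡ false
    simple   : ∀ u v → arc u v ≡ true → arc v u ≡ false

open Digraph public

adjacent : (G : Digraph) → Fin (n G) → Fin (n G) → Bool
adjacent G u v = arc G u v ∨ arc G v u

Independent : (G : Digraph) → Subset (n G) → Set
Independent G S = ∀ u v → u ∈ S → v ∈ S → adjacent G u v ≡ false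

IndependenceNumberIs : Digraph → ℕ → Set
IndependenceNumberIs G k =
  (Σ (Subset (n G)) λ S → Independent G S × ∣ S ∣ ≡ k)
  × (∀ S → Independent G S → ∣ S ∣ ℕ.≤ k)

sumℚ : ∀ {m} → (Fin m → ℚ) → ℚ
sumℚ {zero}  f = 0ℚ
sumℚ {suc m} f = f zero + sumℚ (λ i → f (suc i))

inClosedNbhd : (G : Digraph) → Fin (n G) → Fin (n G) → Bool
inClosedNbhd G v x = ⌊ x ≟ v ⌋ ∨ arc G x v

sumInClosedNbhd : (G : Digraph) → (Fin (n G) → ℚ) → Fin (n G) → ℚ
sumInClosedNbhd G g v = sumℚ (λ x → if′ inClosedNbhd G v x then g x else 0ℚ)
  where
  if′_then_else_ : Bool → ℚ → ℚ → ℚ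
  if′ true  then a else b = a
  if′ false then a else b = b

FracDominating : (G : Digraph) → (Fin (n G) → ℚ) → Set
FracDominating G g =
  (∀ v → 0ℚ ≤ g v) × (∀ v → g v ≤ 1ℚ) × (∀ v → 1ℚ ≤ sumInClosedNbhd G g v)

-- γ*(G) > c : every fractional dominating function has total weight > c
-- (equivalent to min > c since the LP minimum is attained at a rational point).
FracDomNumberGreaterThan : Digraph → ℚ → Set
FracDomNumberGreaterThan G c =
  ∀ (g : Fin (n G) → ℚ) → FracDominating G g → c Data.Rational.< sumℚ g

ℕtoℚ : ℕ → ℚ
ℕtoℚ m = (+ m) / 1

module Submission where

-- G is the disjoint union of k copies of the parity tournament on 2m + 1 vertices.  An
-- independent set meets each tournament in at most one vertex, so α(G) = k.  Every vertex has a
-- closed out-neighbourhood of exactly m + 1 vertices, so summing the constraints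
-- Σ_{x ∈ N⁻[v]} g(x) ≥ 1 over all k(2m + 1) vertices v counts each g(x) exactly m + 1 times:
-- k(2m + 1) ≤ (m + 1) Σ g, i.e. γ*(G) ≥ 2k − k/(m + 1), which exceeds 2k − ε once m + 1 > k/ε.

open import Defs
open import Data.Nat using (ℕ; _≥_; _*_)
open import Data.Rational using (ℚ; 0ℚ; _<_; _-_)
open import Data.Product using (Σ; _×_)

open import Algebra.Bundles using (CommutativeRing)
open import Data.Bool using (Bool; true; false; _∨_; not; if_then_else_)
open import Data.Bool.Properties using (not-involutive; ∨-inverseˡ; ∨-inverseʳ)
open import Data.Fin using (Fin; zero; suc; _↑ˡ_; _↑ʳ_; splitAt; join; _≟_)
open import Data.Fin.Properties using (splitAt-↑ˡ; splitAt-↑ʳ; join-splitAt; ↑ˡ-injective; ↑ʳ-injective)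
open import Data.Fin.Subset using (Subset; _∈_; _⊆_; ∣_∣; ⊥; ⁅_⁆)
open import Data.Fin.Subset.Properties
  using (∣⊥∣≡0; ∣⁅x⁆∣≡1; x∈⁅x⁆; x∈⁅y⁆⇒x≡y; nonempty?; Empty-unique; p⊆q⇒∣p∣≤∣q∣)
import Data.Integer as ℤ
import Data.Integer.Properties as ℤ
open import Data.Integer.Solver using () renaming (module +-*-Solver to ℤ-Solver)
open import Data.Nat as ℕ using (zero; suc; _+_; _≤_; z≤n)
import Data.Nat.Properties as ℕ
open import Data.Nat.Coprimality using (Coprime; 1-coprimeTo) renaming (sym to coprime-sym)
open import Data.Nat.Solver using () renaming (module +-*-Solver to ℕ-Solver)
open import Data.Product using (∃; _,_)
import Data.Rational as ℚ
import Data.Rational.Properties as ℚ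
open import Data.Rational.Unnormalised using (*≡*)
import Data.Rational.Unnormalised.Properties as ℚᵘ
open import Data.Sum using (_⊎_; inj₁; inj₂; [_,_]′)
open import Data.Vec as Vec using ([]; _∷_; _++_; tabulate; lookup; replicate)
open import Data.Vec.Properties using (lookup-splitAt; lookup-++ˡ; lookup-++ʳ; []=⇒lookup; lookup⇒[]=; tabulate-cong)
open import Function using (_∘_; mk⇔)
open import Relation.Binary.PropositionalEquality
open import Relation.Nullary using (yes; no; contradiction)
open import Relation.Nullary.Decidable using (⌊_⌋; does; isYes≗does; does-⇔; dec-false; ⌊⌋-map′)

open CommutativeRing ℚ.+-*-commutativeRing using (semiring)
open import Algebra.Properties.Semiring.Sum semiring using (sum; sum-cong-≗; ∑-comm; *-distribˡ-sum; sum-replicate)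
open import Algebra.Properties.Semiring.Mult semiring using (×-homo-+; ×1-homo-*; ×-assoc-*)
  renaming (_×_ to _×ℚ_)

sumℚ≡sum : ∀ {m} (f : Fin m → ℚ) → sumℚ f ≡ sum f
sumℚ≡sum {zero}  f = refl
sumℚ≡sum {suc m} f = cong (f zero ℚ.+_) (sumℚ≡sum (f ∘ suc))

sum-mono-≤ : ∀ {m} {f g : Fin m → ℚ} → (∀ i → f i ℚ.≤ g i) → sum f ℚ.≤ sum g
sum-mono-≤ {zero}  f≤g = ℚ.≤-refl
sum-mono-≤ {suc m} f≤g = ℚ.+-mono-≤ (f≤g zero) (sum-mono-≤ (f≤g ∘ suc))

-- ℕtoℚ m is built by normalising (+ m) / 1, which does not compute for a variable m;
-- m /1 is the same rational in constructor form, whose numerator and denominator are visible.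
_/1 : ℕ → ℚ
m /1 = ℚ.mkℚ (ℤ.+ m) 0 (coprime-sym (1-coprimeTo m))

ℕtoℚ≡/1 : ∀ m → ℕtoℚ m ≡ m /1
ℕtoℚ≡/1 m = ℚ.↥p/↧p≡p (m /1)

ℕtoℚ-suc : ∀ m → ℕtoℚ (suc m) ≡ ℚ.1ℚ ℚ.+ ℕtoℚ m
ℕtoℚ-suc m rewrite ℕtoℚ≡/1 m | ℕtoℚ≡/1 (suc m) =
  ℚ.toℚᵘ-injective (ℚᵘ.≃-sym (ℚᵘ.≃-trans (ℚ.toℚᵘ-homo-+ ℚ.1ℚ (m /1))
                                         (*≡* (cross-multiplied (ℤ.+ m)))))
  where
  open ℤ-Solver
  cross-multiplied : ∀ i → (ℤ.+ 1 ℤ.* ℤ.+ 1 ℤ.+ i ℤ.* ℤ.+ 1) ℤ.* ℤ.+ 1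
                         ≡ (ℤ.+ 1 ℤ.+ i) ℤ.* (ℤ.+ 1 ℤ.* ℤ.+ 1)
  cross-multiplied = solve 1 (λ i → (con (ℤ.+ 1) :* con (ℤ.+ 1) :+ i :* con (ℤ.+ 1)) :* con (ℤ.+ 1)
                                  := (con (ℤ.+ 1) :+ i) :* (con (ℤ.+ 1) :* con (ℤ.+ 1))) refl

ℕtoℚ≡×1 : ∀ m → ℕtoℚ m ≡ m ×ℚ ℚ.1ℚ
ℕtoℚ≡×1 zero    = refl
ℕtoℚ≡×1 (suc m) = trans (ℕtoℚ-suc m) (cong (ℚ.1ℚ ℚ.+_) (ℕtoℚ≡×1 m))

ℕtoℚ-+ : ∀ a b → ℕtoℚ (a + b) ≡ ℕtoℚ a ℚ.+ ℕtoℚ b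
ℕtoℚ-+ a b rewrite ℕtoℚ≡×1 (a + b) | ℕtoℚ≡×1 a | ℕtoℚ≡×1 b = ×-homo-+ ℚ.1ℚ a b

ℕtoℚ-* : ∀ a b → ℕtoℚ (a * b) ≡ ℕtoℚ a ℚ.* ℕtoℚ b
ℕtoℚ-* a b rewrite ℕtoℚ≡×1 (a * b) | ℕtoℚ≡×1 a | ℕtoℚ≡×1 b = ×1-homo-* a b

ℕtoℚ-mono-≤ : ∀ {a b} → a ≤ b → ℕtoℚ a ℚ.≤ ℕtoℚ b
ℕtoℚ-mono-≤ {a} {b} a≤b rewrite ℕtoℚ≡/1 a | ℕtoℚ≡/1 b =
  ℚ.*≤* (subst₂ ℤ._≤_ (sym (ℤ.*-identityʳ _)) (sym (ℤ.*-identityʳ _)) (ℤ.+≤+ a≤b))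

ℕtoℚ-mono-< : ∀ {a b} → a ℕ.< b → ℕtoℚ a < ℕtoℚ b
ℕtoℚ-mono-< {a} {b} a<b rewrite ℕtoℚ≡/1 a | ℕtoℚ≡/1 b =
  ℚ.*<* (subst₂ ℤ._<_ (sym (ℤ.*-identityʳ _)) (sym (ℤ.*-identityʳ _)) (ℤ.+<+ a<b))

sum-if : ∀ {m} (B : Fin m → Bool) a → sum (λ v → if B v then a else 0ℚ) ≡ ℕtoℚ ∣ tabulate B ∣ ℚ.* a
sum-if B a = begin
  sum (λ v → if B v then a else 0ℚ) ≡⟨ sum-if-× B ⟩
  ∣ tabulate B ∣ ×ℚ a                ≡⟨ cong (∣ tabulate B ∣ ×ℚ_) (ℚ.*-identityˡ a) ⟨
  ∣ tabulate B ∣ ×ℚ (ℚ.1ℚ ℚ.* a)     ≡⟨ ×-assoc-* ∣ tabulate B ∣ ℚ.1ℚ a ⟨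
  (∣ tabulate B ∣ ×ℚ ℚ.1ℚ) ℚ.* a     ≡⟨ cong (ℚ._* a) (ℕtoℚ≡×1 ∣ tabulate B ∣) ⟨
  ℕtoℚ ∣ tabulate B ∣ ℚ.* a         ∎
  where
  open ≡-Reasoning
  sum-if-× : ∀ {m} (B : Fin m → Bool) → sum (λ v → if B v then a else 0ℚ) ≡ ∣ tabulate B ∣ ×ℚ a
  sum-if-× {zero}  B = refl
  sum-if-× {suc m} B with B zero
  ... | true  = cong (a ℚ.+_) (sum-if-× (B ∘ suc))
  ... | false = trans (ℚ.+-identityˡ _) (sum-if-× (B ∘ suc))

p*↧p≡↥p : ∀ p d-1 .(c : Coprime (suc p) (suc d-1)) →
          ℚ.mkℚ (ℤ.+ suc p) d-1 c ℚ.* ℕtoℚ (suc d-1) ≡ ℕtoℚ (suc p)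
p*↧p≡↥p p d-1 c rewrite ℕtoℚ≡/1 (suc d-1) | ℕtoℚ≡/1 (suc p) =
  ℚ.toℚᵘ-injective (ℚᵘ.≃-trans (ℚ.toℚᵘ-homo-* (ℚ.mkℚ (ℤ.+ suc p) d-1 c) (suc d-1 /1))
                                (*≡* (cong (λ z → ℤ.+ suc z) cross-multiplied)))
  where
  cross-multiplied : (d-1 + p * suc d-1) * 1 ≡ d-1 * 1 + p * suc (d-1 * 1)
  cross-multiplied = trans (ℕ.*-identityʳ _) (cong (λ z → z + p * suc z) (sym (ℕ.*-identityʳ d-1)))

archimedean : ∀ {ε} → 0ℚ < ε → ∀ k → ∃ λ m → ℕtoℚ k < ε ℚ.* ℕtoℚ (suc m)
archimedean {ℚ.mkℚ (ℤ.+ zero) _ _} (ℚ.*<* (ℤ.+<+ ()))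
archimedean {ℚ.mkℚ ℤ.-[1+ _ ]   _ _} (ℚ.*<* ())
archimedean {ℚ.mkℚ (ℤ.+ suc p) d-1 c} _ k = k + d-1 * suc k , (begin-strict
  ℕtoℚ k                                       <⟨ ℕtoℚ-mono-< (ℕ.m≤n*m (suc k) (suc p)) ⟩
  ℕtoℚ (suc p * suc k)                         ≡⟨ ℕtoℚ-* (suc p) (suc k) ⟩
  ℕtoℚ (suc p) ℚ.* ℕtoℚ (suc k)                ≡⟨ cong (ℚ._* ℕtoℚ (suc k)) (p*↧p≡↥p p d-1 c) ⟨
  ε ℚ.* ℕtoℚ (suc d-1) ℚ.* ℕtoℚ (suc k)        ≡⟨ ℚ.*-assoc ε (ℕtoℚ (suc d-1)) (ℕtoℚ (suc k)) ⟩
  ε ℚ.* (ℕtoℚ (suc d-1) ℚ.* ℕtoℚ (suc k))      ≡⟨ cong (ε ℚ.*_) (ℕtoℚ-* (suc d-1) (suc k)) ⟨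
  ε ℚ.* ℕtoℚ (suc d-1 * suc k)                 ∎)
  where
  ε : ℚ
  ε = ℚ.mkℚ (ℤ.+ suc p) d-1 c
  open ℚ.≤-Reasoning

closedOutNbhd : (G : Digraph) → Fin (n G) → Subset (n G)
closedOutNbhd G x = tabulate (λ v → inClosedNbhd G v x)

MaxClosedOutDegree≤ : Digraph → ℕ → Set
MaxClosedOutDegree≤ G d = ∀ x → ∣ closedOutNbhd G x ∣ ≤ d

-- The summand of sumInClosedNbhd is local to a where-block of Defs and cannot be named,
-- so the left-hand side of summand-if is left to unification.
mutual
  sumInClosedNbhd≡sum : ∀ G g v → sumInClosedNbhd G g v ≡ sum (λ x → if inClosedNbhd G v x then g x else 0ℚ)
  sumInClosedNbhd≡sum G g v = trans (sumℚ≡sum {n G} _) (sum-cong-≗ (summand-if G g v))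

  summand-if : ∀ G g v x → _ ≡ (if inClosedNbhd G v x then g x else 0ℚ)
  summand-if G g v x with inClosedNbhd G v x
  ... | true  = refl
  ... | false = refl

sum-sumInClosedNbhd : ∀ G g → sum (sumInClosedNbhd G g) ≡ sum (λ x → ℕtoℚ ∣ closedOutNbhd G x ∣ ℚ.* g x)
sum-sumInClosedNbhd G g = begin
  sum (sumInClosedNbhd G g)           ≡⟨ sum-cong-≗ (sumInClosedNbhd≡sum G g) ⟩
  sum (λ v → sum (λ x → [v∈N⁺ x ] v)) ≡⟨ ∑-comm (λ v x → [v∈N⁺ x ] v) ⟩
  sum (λ x → sum [v∈N⁺ x ])           ≡⟨ sum-cong-≗ (λ x → sum-if (λ v → inClosedNbhd G v x) (g x)) ⟩
  sum (λ x → ℕtoℚ ∣ closedOutNbhd G x ∣ ℚ.* g x) ∎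
  where
  open ≡-Reasoning
  [v∈N⁺_] : Fin (n G) → Fin (n G) → ℚ
  [v∈N⁺ x ] v = if inClosedNbhd G v x then g x else 0ℚ

fracDominating⇒n≤d*∑g : ∀ G d {g} → MaxClosedOutDegree≤ G d → FracDominating G g →
                        ℕtoℚ (n G) ℚ.≤ ℕtoℚ d ℚ.* sumℚ g
fracDominating⇒n≤d*∑g G d {g} Δ≤d (g≥0 , _ , dominated) = begin
  ℕtoℚ (n G)                                         ≡⟨ ℕtoℚ≡×1 (n G) ⟩
  n G ×ℚ ℚ.1ℚ                                        ≡⟨ sum-replicate (n G) ⟨
  sum {n G} (λ _ → ℚ.1ℚ)                             ≤⟨ sum-mono-≤ dominated ⟩
  sum (sumInClosedNbhd G g)                          ≡⟨ sum-sumInClosedNbhd G g ⟩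
  sum (λ x → ℕtoℚ ∣ closedOutNbhd G x ∣ ℚ.* g x)     ≤⟨ sum-mono-≤ (λ x → weight≤ x (ℕtoℚ-mono-≤ (Δ≤d x))) ⟩
  sum (λ x → ℕtoℚ d ℚ.* g x)                         ≡⟨ *-distribˡ-sum (ℕtoℚ d) g ⟨
  ℕtoℚ d ℚ.* sum g                                   ≡⟨ cong (ℕtoℚ d ℚ.*_) (sumℚ≡sum g) ⟨
  ℕtoℚ d ℚ.* sumℚ g                                  ∎
  where
  open ℚ.≤-Reasoning
  weight≤ : ∀ x {p q} → p ℚ.≤ q → p ℚ.* g x ℚ.≤ q ℚ.* g x
  weight≤ x = ℚ.*-monoʳ-≤-nonNeg (g x) {{ℚ.nonNegative (g≥0 x)}}

∣p++q∣≡∣p∣+∣q∣ : ∀ {a b} (p : Subset a) (q : Subset b) → ∣ p ++ q ∣ ≡ ∣ p ∣ + ∣ q ∣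
∣p++q∣≡∣p∣+∣q∣ []          q = refl
∣p++q∣≡∣p∣+∣q∣ (true  ∷ p) q = cong suc (∣p++q∣≡∣p∣+∣q∣ p q)
∣p++q∣≡∣p∣+∣q∣ (false ∷ p) q = ∣p++q∣≡∣p∣+∣q∣ p q

tabulate-++ : ∀ {A : Set} a {b} (f : Fin (a + b) → A) →
              tabulate f ≡ tabulate (f ∘ (_↑ˡ b)) ++ tabulate (f ∘ (a ↑ʳ_))
tabulate-++ zero    f = refl
tabulate-++ (suc a) f = cong (f zero ∷_) (tabulate-++ a (f ∘ suc))

tabulate-const : ∀ {A : Set} {m} (x : A) → tabulate {n = m} (λ _ → x) ≡ replicate m x
tabulate-const {m = zero}  x = refl
tabulate-const {m = suc m} x = cong (x ∷_) (tabulate-const x)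

⌊≟⌋-injective : ∀ {a b} {f : Fin a → Fin b} → (∀ {i j} → f i ≡ f j → i ≡ j) →
                ∀ i j → ⌊ f i ≟ f j ⌋ ≡ ⌊ i ≟ j ⌋
⌊≟⌋-injective {f = f} f-inj i j = begin
  ⌊ f i ≟ f j ⌋    ≡⟨ isYes≗does (f i ≟ f j) ⟩
  does (f i ≟ f j) ≡⟨ does-⇔ (mk⇔ f-inj (cong f)) (f i ≟ f j) (i ≟ j) ⟩
  does (i ≟ j)     ≡⟨ isYes≗does (i ≟ j) ⟨
  ⌊ i ≟ j ⌋        ∎
  where open ≡-Reasoning

⌊≟⌋-≢ : ∀ {m} {x y : Fin m} → x ≢ y → ⌊ x ≟ y ⌋ ≡ false
⌊≟⌋-≢ {x = x} {y} x≢y = trans (isYes≗does (x ≟ y)) (dec-false (x ≟ y) x≢y)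

↑ˡ≢↑ʳ : ∀ {a b} (i : Fin a) (j : Fin b) → i ↑ˡ b ≢ a ↑ʳ j
↑ˡ≢↑ʳ {a} {b} i j eq with () ← trans (sym (splitAt-↑ˡ a i b)) (trans (cong (splitAt a) eq) (splitAt-↑ʳ a b j))

arc⊎ : (G H : Digraph) → Fin (n G) ⊎ Fin (n H) → Fin (n G) ⊎ Fin (n H) → Bool
arc⊎ G H (inj₁ u) (inj₁ v) = arc G u v
arc⊎ G H (inj₂ u) (inj₂ v) = arc H u v
arc⊎ G H _        _        = false

arc⊎-loopless : ∀ G H x → arc⊎ G H x x ≡ false
arc⊎-loopless G H (inj₁ u) = loopless G u
arc⊎-loopless G H (inj₂ u) = loopless H u

arc⊎-simple : ∀ G H x y → arc⊎ G H x y ≡ true → arc⊎ G H y x ≡ false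
arc⊎-simple G H (inj₁ u) (inj₁ v) = simple G u v
arc⊎-simple G H (inj₂ u) (inj₂ v) = simple H u v
arc⊎-simple G H (inj₁ u) (inj₂ v) ()
arc⊎-simple G H (inj₂ u) (inj₁ v) ()

infixr 5 _⊕_

_⊕_ : Digraph → Digraph → Digraph
G ⊕ H = record
  { n        = n G + n H
  ; arc      = λ u v → arc⊎ G H (splitAt (n G) u) (splitAt (n G) v)
  ; loopless = λ v → arc⊎-loopless G H (splitAt (n G) v)
  ; simple   = λ u v → arc⊎-simple G H (splitAt (n G) u) (splitAt (n G) v)
  }

module _ (G H : Digraph) where

  adjacent-⊕-↑ˡ : ∀ u v → adjacent (G ⊕ H) (u ↑ˡ n H) (v ↑ˡ n H) ≡ adjacent G u v
  adjacent-⊕-↑ˡ u v rewrite splitAt-↑ˡ (n G) u (n H) | splitAt-↑ˡ (n G) v (n H) = refl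

  adjacent-⊕-↑ʳ : ∀ u v → adjacent (G ⊕ H) (n G ↑ʳ u) (n G ↑ʳ v) ≡ adjacent H u v
  adjacent-⊕-↑ʳ u v rewrite splitAt-↑ʳ (n G) (n H) u | splitAt-↑ʳ (n G) (n H) v = refl

module _ {a b} (S : Subset a) (T : Subset b) where

  ∈-++⁺ˡ : ∀ {i} → i ∈ S → i ↑ˡ b ∈ S ++ T
  ∈-++⁺ˡ {i} i∈S = lookup⇒[]= (i ↑ˡ b) (S ++ T) (trans (lookup-++ˡ S T i) ([]=⇒lookup i∈S))

  ∈-++⁺ʳ : ∀ {j} → j ∈ T → a ↑ʳ j ∈ S ++ T
  ∈-++⁺ʳ {j} j∈T = lookup⇒[]= (a ↑ʳ j) (S ++ T) (trans (lookup-++ʳ S T j) ([]=⇒lookup j∈T))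

  ∈-++⁻ : ∀ {u} → u ∈ S ++ T → [ _∈ S , _∈ T ]′ (splitAt a u)
  ∈-++⁻ {u} u∈ = lemma (splitAt a u) (trans (sym (lookup-splitAt a S T u)) ([]=⇒lookup u∈))
    where
    lemma : ∀ x → [ lookup S , lookup T ]′ x ≡ true → [ _∈ S , _∈ T ]′ x
    lemma (inj₁ i) = lookup⇒[]= i S
    lemma (inj₂ j) = lookup⇒[]= j T

module _ {G H : Digraph} {S : Subset (n G)} {T : Subset (n H)} where

  independent-++ : Independent G S → Independent H T → Independent (G ⊕ H) (S ++ T)
  independent-++ indS indT u v u∈ v∈ =
    independent⊎ (splitAt (n G) u) (splitAt (n G) v) (∈-++⁻ S T u∈) (∈-++⁻ S T v∈)
    where
    independent⊎ : ∀ x y → [ _∈ S , _∈ T ]′ x → [ _∈ S , _∈ T ]′ y →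
                   (arc⊎ G H x y ∨ arc⊎ G H y x) ≡ false
    independent⊎ (inj₁ u) (inj₁ v) = indS u v
    independent⊎ (inj₂ u) (inj₂ v) = indT u v
    independent⊎ (inj₁ u) (inj₂ v) _ _ = refl
    independent⊎ (inj₂ u) (inj₁ v) _ _ = refl

  independent-++⁻ : Independent (G ⊕ H) (S ++ T) → Independent G S × Independent H T
  independent-++⁻ ind =
    (λ u v u∈ v∈ → trans (sym (adjacent-⊕-↑ˡ G H u v)) (ind _ _ (∈-++⁺ˡ S T u∈) (∈-++⁺ˡ S T v∈))) ,
    (λ u v u∈ v∈ → trans (sym (adjacent-⊕-↑ʳ G H u v)) (ind _ _ (∈-++⁺ʳ S T u∈) (∈-++⁺ʳ S T v∈)))

independenceNumber-⊕ : ∀ {G H a b} → IndependenceNumberIs G a → IndependenceNumberIs H b →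
                       IndependenceNumberIs (G ⊕ H) (a + b)
independenceNumber-⊕ {G} {H} {a} {b} ((S , indS , ∣S∣≡a) , maxG) ((T , indT , ∣T∣≡b) , maxH) =
  (S ++ T , independent-++ indS indT , trans (∣p++q∣≡∣p∣+∣q∣ S T) (cong₂ _+_ ∣S∣≡a ∣T∣≡b)) , max
  where
  max : ∀ U → Independent (G ⊕ H) U → ∣ U ∣ ≤ a + b
  max U indU with Vec.splitAt (n G) U
  ... | S′ , T′ , refl with independent-++⁻ indU
  ...   | indS′ , indT′ =
    subst (_≤ a + b) (sym (∣p++q∣≡∣p∣+∣q∣ S′ T′)) (ℕ.+-mono-≤ (maxG S′ indS′) (maxH T′ indT′))

module _ (G H : Digraph) where

  closedOutNbhd-⊕ˡ : ∀ i → closedOutNbhd (G ⊕ H) (i ↑ˡ n H) ≡ closedOutNbhd G i ++ ⊥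
  closedOutNbhd-⊕ˡ i =
    trans (tabulate-++ (n G) f) (cong₂ _++_ (tabulate-cong inside) (trans (tabulate-cong outside) (tabulate-const false)))
    where
    f : Fin (n G + n H) → Bool
    f v = inClosedNbhd (G ⊕ H) v (i ↑ˡ n H)
    inside : ∀ j → f (j ↑ˡ n H) ≡ inClosedNbhd G j i
    inside j = cong₂ _∨_ (⌊≟⌋-injective (↑ˡ-injective (n H) _ _) i j)
                         (cong₂ (arc⊎ G H) (splitAt-↑ˡ (n G) i (n H)) (splitAt-↑ˡ (n G) j (n H)))
    outside : ∀ j → f (n G ↑ʳ j) ≡ false
    outside j = cong₂ _∨_ (⌊≟⌋-≢ (↑ˡ≢↑ʳ i j))
                          (cong₂ (arc⊎ G H) (splitAt-↑ˡ (n G) i (n H)) (splitAt-↑ʳ (n G) (n H) j))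

  closedOutNbhd-⊕ʳ : ∀ j → closedOutNbhd (G ⊕ H) (n G ↑ʳ j) ≡ ⊥ ++ closedOutNbhd H j
  closedOutNbhd-⊕ʳ j =
    trans (tabulate-++ (n G) f) (cong₂ _++_ (trans (tabulate-cong outside) (tabulate-const false)) (tabulate-cong inside))
    where
    f : Fin (n G + n H) → Bool
    f v = inClosedNbhd (G ⊕ H) v (n G ↑ʳ j)
    inside : ∀ i → f (n G ↑ʳ i) ≡ inClosedNbhd H i j
    inside i = cong₂ _∨_ (⌊≟⌋-injective (↑ʳ-injective (n G) _ _) j i)
                         (cong₂ (arc⊎ G H) (splitAt-↑ʳ (n G) (n H) j) (splitAt-↑ʳ (n G) (n H) i))
    outside : ∀ i → f (i ↑ˡ n H) ≡ false
    outside i = cong₂ _∨_ (⌊≟⌋-≢ (↑ˡ≢↑ʳ i j ∘ sym))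
                          (cong₂ (arc⊎ G H) (splitAt-↑ʳ (n G) (n H) j) (splitAt-↑ˡ (n G) i (n H)))

  maxClosedOutDegree-⊕ : ∀ {d} → MaxClosedOutDegree≤ G d → MaxClosedOutDegree≤ H d → MaxClosedOutDegree≤ (G ⊕ H) d
  maxClosedOutDegree-⊕ {d} ΔG ΔH x =
    subst (λ x → ∣ closedOutNbhd (G ⊕ H) x ∣ ≤ d) (join-splitAt (n G) (n H) x) (bound (splitAt (n G) x))
    where
    bound : ∀ s → ∣ closedOutNbhd (G ⊕ H) (join (n G) (n H) s) ∣ ≤ d
    bound (inj₁ i) rewrite closedOutNbhd-⊕ˡ i | ∣p++q∣≡∣p∣+∣q∣ (closedOutNbhd G i) (⊥ {n H})
                         | ∣⊥∣≡0 (n H) | ℕ.+-identityʳ ∣ closedOutNbhd G i ∣ = ΔG i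
    bound (inj₂ j) rewrite closedOutNbhd-⊕ʳ j | ∣p++q∣≡∣p∣+∣q∣ (⊥ {n G}) (closedOutNbhd H j)
                         | ∣⊥∣≡0 (n G) = ΔH j

emptyDigraph : Digraph
emptyDigraph = record { n = 0 ; arc = λ () ; loopless = λ () ; simple = λ () }

independenceNumber-empty : IndependenceNumberIs emptyDigraph 0
independenceNumber-empty = ([] , (λ ()) , refl) , λ { [] _ → z≤n }

copies : ℕ → Digraph → Digraph
copies zero    T = emptyDigraph
copies (suc k) T = T ⊕ copies k T

n-copies : ∀ k T → n (copies k T) ≡ k * n T
n-copies zero    T = refl
n-copies (suc k) T = cong (n T +_) (n-copies k T)

independenceNumber-copies : ∀ k {T a} → IndependenceNumberIs T a → IndependenceNumberIs (copies k T) (k * a)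
independenceNumber-copies zero    α≡a = independenceNumber-empty
independenceNumber-copies (suc k) α≡a = independenceNumber-⊕ α≡a (independenceNumber-copies k α≡a)

maxClosedOutDegree-copies : ∀ k {T d} → MaxClosedOutDegree≤ T d → MaxClosedOutDegree≤ (copies k T) d
maxClosedOutDegree-copies zero    Δ≤d = λ ()
maxClosedOutDegree-copies (suc k) Δ≤d = maxClosedOutDegree-⊕ _ _ Δ≤d (maxClosedOutDegree-copies k Δ≤d)

IsTournament : Digraph → Set
IsTournament G = ∀ u v → u ≢ v → adjacent G u v ≡ true

independenceNumber-tournament : ∀ {G} → IsTournament G → Fin (n G) → IndependenceNumberIs G 1
independenceNumber-tournament {G} tournament v = (⁅ v ⁆ , singleton-independent , ∣⁅x⁆∣≡1 v) , atMostOne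
  where
  singleton-independent : Independent G ⁅ v ⁆
  singleton-independent u w u∈ w∈ rewrite x∈⁅y⁆⇒x≡y v u∈ | x∈⁅y⁆⇒x≡y v w∈ =
    cong₂ _∨_ (loopless G v) (loopless G v)
  atMostOne : ∀ S → Independent G S → ∣ S ∣ ≤ 1
  atMostOne S indS with nonempty? S
  ... | no S-empty rewrite Empty-unique S-empty | ∣⊥∣≡0 (n G) = z≤n
  ... | yes (u , u∈S) = subst (∣ S ∣ ≤_) (∣⁅x⁆∣≡1 u) (p⊆q⇒∣p∣≤∣q∣ S⊆⁅u⁆)
    where
    S⊆⁅u⁆ : S ⊆ ⁅ u ⁆
    S⊆⁅u⁆ {w} w∈S with w ≟ u
    ... | yes refl = x∈⁅x⁆ w
    ... | no w≢u with () ← trans (sym (indS w u w∈S u∈S)) (tournament w u w≢u)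

evenᶠ : ∀ {n} → Fin n → Bool
evenᶠ zero          = true
evenᶠ (suc zero)    = false
evenᶠ (suc (suc i)) = evenᶠ i

evenᶠ-suc : ∀ {n} (i : Fin n) → evenᶠ (suc i) ≡ not (evenᶠ i)
evenᶠ-suc zero          = refl
evenᶠ-suc (suc zero)    = refl
evenᶠ-suc (suc (suc i)) = evenᶠ-suc i

-- i → j iff either i < j and j − i is odd, or i > j and i − j is even.
parityArc : ∀ {n} → Fin n → Fin n → Bool
parityArc zero    zero    = false
parityArc zero    (suc j) = evenᶠ j
parityArc (suc i) zero    = not (evenᶠ i)
parityArc (suc i) (suc j) = parityArc i j

parityArc-loopless : ∀ {n} (i : Fin n) → parityArc i i ≡ false
parityArc-loopless zero    = refl
parityArc-loopless (suc i) = parityArc-loopless i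

parityArc-simple : ∀ {n} (i j : Fin n) → parityArc i j ≡ true → parityArc j i ≡ false
parityArc-simple zero    zero    ()
parityArc-simple zero    (suc j) even rewrite even = refl
parityArc-simple (suc i) zero    odd  = trans (sym (not-involutive (evenᶠ i))) (cong not odd)
parityArc-simple (suc i) (suc j) = parityArc-simple i j

parityTournament : ℕ → Digraph
parityTournament N = record { n = N ; arc = parityArc ; loopless = parityArc-loopless ; simple = parityArc-simple }

parityTournament-isTournament : ∀ N → IsTournament (parityTournament N)
parityTournament-isTournament N zero    zero    0≢0 = contradiction refl 0≢0
parityTournament-isTournament N zero    (suc j) _   = ∨-inverseʳ (evenᶠ j)
parityTournament-isTournament N (suc i) zero    _   = ∨-inverseˡ (evenᶠ i)
parityTournament-isTournament (suc N) (suc i) (suc j) i≢j = parityTournament-isTournament N i j (i≢j ∘ cong suc)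

double : ℕ → ℕ
double zero    = zero
double (suc m) = suc (suc (double m))

∣evens∣-double : ∀ m → ∣ tabulate {n = double m} evenᶠ ∣ ≡ m
∣evens∣-double zero    = refl
∣evens∣-double (suc m) = cong suc (∣evens∣-double m)

∣evens∣-suc-double : ∀ m → ∣ tabulate {n = suc (double m)} evenᶠ ∣ ≡ suc m
∣evens∣-suc-double zero    = refl
∣evens∣-suc-double (suc m) = cong suc (∣evens∣-suc-double m)

closedOutNbhd-parity-suc : ∀ N (i : Fin N) →
  closedOutNbhd (parityTournament (suc N)) (suc i) ≡ not (evenᶠ i) ∷ closedOutNbhd (parityTournament N) i
closedOutNbhd-parity-suc N i =
  cong (not (evenᶠ i) ∷_) (tabulate-cong (λ j → cong (_∨ parityArc i j) (⌊⌋-map′ _ _ (i ≟ j))))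

closedOutDegree-parity : ∀ m (x : Fin (suc (double m))) → ∣ closedOutNbhd (parityTournament (suc (double m))) x ∣ ≡ suc m
closedOutDegree-parity zero    zero = refl
closedOutDegree-parity (suc m) zero = cong (ℕ.suc ∘ ℕ.suc) (∣evens∣-double m)
closedOutDegree-parity (suc m) (suc zero) = cong suc (∣evens∣-suc-double m)
closedOutDegree-parity (suc m) (suc (suc i)) = begin
  ∣ closedOutNbhd (parityTournament (suc (double (suc m)))) (suc (suc i)) ∣
    ≡⟨ cong ∣_∣ (trans (closedOutNbhd-parity-suc _ (suc i))
                       (cong (not (evenᶠ (suc i)) ∷_) (closedOutNbhd-parity-suc _ i))) ⟩
  ∣ not (evenᶠ (suc i)) ∷ not (evenᶠ i) ∷ N⁺[i] ∣
    ≡⟨ cong (λ b → ∣ not b ∷ not (evenᶠ i) ∷ N⁺[i] ∣) (evenᶠ-suc i) ⟩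
  ∣ not (not (evenᶠ i)) ∷ not (evenᶠ i) ∷ N⁺[i] ∣
    ≡⟨ exactly-one (evenᶠ i) ⟩
  suc ∣ N⁺[i] ∣
    ≡⟨ cong suc (closedOutDegree-parity m i) ⟩
  suc (suc m) ∎
  where
  open ≡-Reasoning
  N⁺[i] : Subset (suc (double m))
  N⁺[i] = closedOutNbhd (parityTournament (suc (double m))) i
  exactly-one : ∀ b → ∣ not (not b) ∷ not b ∷ N⁺[i] ∣ ≡ suc ∣ N⁺[i] ∣
  exactly-one true  = refl
  exactly-one false = refl

double≡2* : ∀ m → double m ≡ 2 * m
double≡2* zero    = refl
double≡2* (suc m) = cong suc (trans (cong suc (double≡2* m)) (sym (ℕ.+-suc m (m + 0))))

2k-ε<weight : ∀ k m {w ε} → ℕtoℚ (k * suc (double m)) ℚ.≤ ℕtoℚ (suc m) ℚ.* w →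
              ℕtoℚ k < ε ℚ.* ℕtoℚ (suc m) → ℕtoℚ (2 * k) - ε < w
2k-ε<weight k m {w} {ε} n≤[m+1]w k<ε[m+1] = begin-strict
  ℕtoℚ (2 * k) - ε         <⟨ ℚ.+-monoˡ-< (ℚ.- ε) 2k<w+ε ⟩
  w ℚ.+ ε - ε              ≡⟨ ℚ.+-assoc w ε (ℚ.- ε) ⟩
  w ℚ.+ (ε - ε)            ≡⟨ cong (w ℚ.+_) (ℚ.+-inverseʳ ε) ⟩
  w ℚ.+ 0ℚ                 ≡⟨ ℚ.+-identityʳ w ⟩
  w                        ∎
  where
  open ℚ.≤-Reasoning
  m+1 : ℚ
  m+1 = ℕtoℚ (suc m)
  2k[m+1]≡k[2m+1]+k : 2 * k * suc m ≡ k * suc (double m) + k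
  2k[m+1]≡k[2m+1]+k rewrite double≡2* m =
    solve 2 (λ k m → con 2 :* k :* (con 1 :+ m) := k :* (con 1 :+ con 2 :* m) :+ k) refl k m
    where open ℕ-Solver
  2k[m+1]<[w+ε][m+1] : ℕtoℚ (2 * k) ℚ.* m+1 < (w ℚ.+ ε) ℚ.* m+1
  2k[m+1]<[w+ε][m+1] = begin-strict
    ℕtoℚ (2 * k) ℚ.* m+1                       ≡⟨ ℕtoℚ-* (2 * k) (suc m) ⟨
    ℕtoℚ (2 * k * suc m)                       ≡⟨ cong ℕtoℚ 2k[m+1]≡k[2m+1]+k ⟩
    ℕtoℚ (k * suc (double m) + k)              ≡⟨ ℕtoℚ-+ (k * suc (double m)) k ⟩
    ℕtoℚ (k * suc (double m)) ℚ.+ ℕtoℚ k       <⟨ ℚ.+-mono-≤-< n≤[m+1]w k<ε[m+1] ⟩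
    m+1 ℚ.* w ℚ.+ ε ℚ.* m+1                    ≡⟨ cong (ℚ._+ ε ℚ.* m+1) (ℚ.*-comm m+1 w) ⟩
    w ℚ.* m+1 ℚ.+ ε ℚ.* m+1                    ≡⟨ ℚ.*-distribʳ-+ m+1 w ε ⟨
    (w ℚ.+ ε) ℚ.* m+1                          ∎
  2k<w+ε : ℕtoℚ (2 * k) < w ℚ.+ ε
  2k<w+ε = ℚ.*-cancelʳ-<-nonNeg m+1 {{ℚ.nonNegative (ℕtoℚ-mono-≤ {b = suc m} z≤n)}} 2k[m+1]<[w+ε][m+1]

proposition9 : ∀ (ε : ℚ) → 0ℚ < ε → ∀ (k : ℕ) → k ≥ 1 →
    Σ Digraph λ G → IndependenceNumberIs G k
    × FracDomNumberGreaterThan G (ℕtoℚ (2 * k) - ε)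
proposition9 ε ε>0 k _ with archimedean ε>0 k
... | m , k<ε[m+1] = G , α[G]≡k , γ*[G]>2k-ε
  where
  T G : Digraph
  T = parityTournament (suc (double m))
  G = copies k T
  α[G]≡k : IndependenceNumberIs G k
  α[G]≡k = subst (IndependenceNumberIs G) (ℕ.*-identityʳ k)
             (independenceNumber-copies k (independenceNumber-tournament {T} (parityTournament-isTournament _) zero))
  Δ⁺[G]≤m+1 : MaxClosedOutDegree≤ G (suc m)
  Δ⁺[G]≤m+1 = maxClosedOutDegree-copies k (ℕ.≤-reflexive ∘ closedOutDegree-parity m)
  γ*[G]>2k-ε : FracDomNumberGreaterThan G (ℕtoℚ (2 * k) - ε)
  γ*[G]>2k-ε g dominating = 2k-ε<weight k m n≤[m+1]∑g k<ε[m+1]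
    where
    n≤[m+1]∑g : ℕtoℚ (k * suc (double m)) ℚ.≤ ℕtoℚ (suc m) ℚ.* sumℚ g
    n≤[m+1]∑g = subst (λ N → ℕtoℚ N ℚ.≤ ℕtoℚ (suc m) ℚ.* sumℚ g) (n-copies k T)
                      (fracDominating⇒n≤d*∑g G (suc m) Δ⁺[G]≤m+1 dominating)
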